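{- Let $G_4=(V,E)$ be a finite digraph whose vertex set is partitioned as $V=V_1\cup W_1$ with $V_1\cap W_1=\varnothing$, $V_1=\{v_1,\dots,v_n\}$, $W_1=\{w_1,\dots,w_m\}$, such that for every $v\in V_1$ and every $w\in W_1$ there is exactly one directed edge $(v,w)\in E$, and $d_{\mathrm{out}}(w)=0$ for every $w\in W_1$ (edges among vertices of $V_1$ are arbitrary). Write a position of Digraph Yama Nim on $G_4$ as $(x_1,\dots,x_n,y_1,\dots,y_m)$, where $x_i$ is the number of tokens on $v_i$ and $y_j$ the number on $w_j$. If $m=|W_1|$ is odd, then the Sprague–Grundy value of this position is $$g(x_1,\dots,x_n,y_1,\dots,y_m)=y_1\oplus y_2\oplus\cdots\oplus y_m.$$ In particular, the position is a $\mathcal{P}$-position if and only if $y_1\oplus\cdots\oplus y_m=0$.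
   Context: Digraph Yama Nim on a finite digraph $G=(V,E)$: a position assigns a non-negative integer number of tokens to each vertex. On a turn, a player chooses a vertex $v$ and removes at least $d_{\mathrm{out}}(v)+1$ tokens from $v$ (where $d_{\mathrm{out}}(v)$ is the out-degree of $v$), and simultaneously adds one token to each out-neighbour of $v$; other counts are unchanged. Normal play: the player making the last move wins. A $\mathcal{P}$-position is one where the previous player (not the player to move) has a winning strategy. The Sprague–Grundy value is defined recursively by $g(p)=\mathrm{mex}\{g(p')\mid p' \text{ an option of } p\}$, where $\mathrm{mex}(X)$ is the least non-negative integer not in $X$. $\oplus$ denotes bitwise XOR (nim-sum) of non-negative integers in binary. -}

module Defs where

open import Data.Nat using (ℕ; zero; suc; _+_; _*_; _∸_; _≡ᵇ_)
open import Data.Nat.DivMod using (_/_; _%_)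
open import Data.Bool using (Bool; true; false; if_then_else_; not)
open import Data.Fin using (Fin; _≟_)
open import Data.List using (List; []; _∷_; map; concatMap; upTo; foldr; length; allFin; tabulate)
open import Data.Nat.ListAction using (sum)
open import Data.Bool.ListAction using (or; and)
open import Relation.Nullary.Decidable using (does)
open import Relation.Binary.PropositionalEquality using (_≡_)

-- Bitwise XOR (nim-sum) on ℕ.
-- xorF f a b processes f binary digits; fuel a + b is always enough.

xorF : ℕ → ℕ → ℕ → ℕ
xorF zero    a b = 0
xorF (suc f) a b =
  (if (a % 2) ≡ᵇ (b % 2) then 0 else 1) + 2 * xorF f (a / 2) (b / 2)

_⊕_ : ℕ → ℕ → ℕ
a ⊕ b = xorF (a + b) a b

infixl 6 _⊕_

⨁ : ∀ {m} → (Fin m → ℕ) → ℕ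
⨁ {m} y = foldr _⊕_ 0 (tabulate y)

-- mex of a finite list: least k not in the list (always ≤ length)

_∈ᵇ_ : ℕ → List ℕ → Bool
k ∈ᵇ xs = or (map (λ x → x ≡ᵇ k) xs)

mexSearch : ℕ → ℕ → List ℕ → ℕ
mexSearch zero    k xs = k
mexSearch (suc f) k xs = if k ∈ᵇ xs then mexSearch f (suc k) xs else k

mex : List ℕ → ℕ
mex xs = mexSearch (length xs) 0 xs

record Digraph (N : ℕ) : Set where
  field
    adj      : Fin N → Fin N → Bool
    loopless : ∀ v → adj v v ≡ false

open Digraph public

toℕᵇ : Bool → ℕ
toℕᵇ true  = 1
toℕᵇ false = 0

outdeg : ∀ {N} → Digraph N → Fin N → ℕ
outdeg G v = sum (map (λ u → toℕᵇ (adj G v u)) (allFin _))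

Position : ℕ → Set
Position N = Fin N → ℕ

total : ∀ {N} → Position N → ℕ
total p = sum (map p (allFin _))

move : ∀ {N} → Digraph N → Position N → Fin N → ℕ → Position N
move G p v r u =
  (if does (u ≟ v) then p v ∸ r else p u) + toℕᵇ (adj G v u)

options : ∀ {N} → Digraph N → Position N → List (Position N)
options G p =
  concatMap
    (λ v → map (λ i → move G p v (suc (outdeg G v) + i))
                (upTo (p v ∸ outdeg G v)))
    (allFin _)

-- Every move strictly decreases the total number
-- of tokens, so every play from p has length ≤ total p; recursion depth
-- suc (total p) therefore computes g(p) = mex { g(p') | p' option of p }
-- exactly.
grundyF : ∀ {N} → Digraph N → ℕ → Position N → ℕ
grundyF G zero    p = 0
grundyF G (suc f) p = mex (map (grundyF G f) (options G p))

grundy : ∀ {N} → Digraph N → Position N → ℕ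
grundy G p = grundyF G (suc (total p)) p

-- P-positions (previous player wins, normal play): every option is an
-- N-position; N-positions have some option that is a P-position.
-- Same depth argument as above.
isPF : ∀ {N} → Digraph N → ℕ → Position N → Bool
isPF G zero    p = true
isPF G (suc f) p = and (map (λ q → not (isPF G f q)) (options G p))

IsPPosition : ∀ {N} → Digraph N → Position N → Set
IsPPosition G p = isPF G (suc (total p)) p ≡ true

module Submission where

-- A move at a vertex of V₁ adds one token to each of the m heaps of W₁; since m is odd this
-- flips the parity of y₁ ⊕ ⋯ ⊕ yₘ, which nim-sum shares with y₁ + ⋯ + yₘ.  A move at a sink
-- w ∈ W₁ only lowers y_w, an ordinary Nim move.  So y₁ ⊕ ⋯ ⊕ yₘ changes along every move, and
-- every smaller value is reached by a Nim move on W₁ (lowering one heap, found by recursion on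
-- binary digits).  As every move lowers the total number of tokens, the mex recursion then
-- identifies this nim-sum with the Sprague–Grundy value; P-positions are those of value 0.

open import Data.Bool using (Bool; true; false; not; _xor_; if_then_else_; T)
open import Data.Bool.ListAction using (and; or)
open import Data.Bool.Properties using (xor-comm; xor-assoc; xor-same; xor-identityʳ)
open import Data.Empty using (⊥-elim)
open import Data.Fin using (Fin; zero; suc; toℕ; punchIn; _↑ˡ_; _↑ʳ_; splitAt)
import Data.Fin as Fin
open import Data.Fin.Properties
  using (toℕ<n; pigeonhole; punchInᵢ≢i; splitAt-↑ˡ; splitAt-↑ʳ; ↑ʳ-injective)
open import Data.List using (List; []; _∷_; length; map; lookup; allFin; tabulate; upTo)
open import Data.List.Membership.Propositional using (_∈_; _∉_; find; lose)
open import Data.List.Membership.Propositional.Properties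
  using (∈-concatMap⁺; ∈-concatMap⁻; ∈-map⁺; ∈-map⁻; ∈-allFin; ∈-upTo⁺; ∈-upTo⁻)
open import Data.List.Properties using (map-tabulate; map-cong; map-∘)
import Data.List.Relation.Unary.Any as Any
open import Data.List.Relation.Unary.Any.Properties using (any⁺; any⁻; lookup-index)
open import Data.Nat using (ℕ; zero; suc; parity; _+_; _*_; _∸_; _≡ᵇ_; _≤_; _<_; z≤n; s≤s)
open import Data.Nat.Divisibility using (n∣m*n)
open import Data.Nat.DivMod
  using (_/_; _%_; m/n≤m; m/n<m; /-monoˡ-≤; [m+kn]%n≡m%n; +-distrib-/-∣ʳ; m*n/n≡m)
open import Data.Nat.ListAction using (sum)
open import Data.Nat.Properties
  using (_≟_; _≤?_; ≡ᵇ⇒≡; ≡⇒≡ᵇ; ≤-refl; ≤-reflexive; ≤-trans; ≤-antisym; ≤-pred; <⇒≤; <⇒≢;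
         ≤∧≢⇒<; ≰⇒>; <-cmp; <-asym; <-≤-trans; ≤-<-trans; n<1+n; n≤1+n; m≤m+n; m≤n+m;
         +-comm; +-suc; +-identityʳ; +-mono-≤; +-monoˡ-≤; +-monoˡ-<; +-monoʳ-<; +-cancelʳ-<;
         *-comm; *-monoˡ-≤; m+[n∸m]≡n; m∸n+n≡m; m∸[m∸n]≡n; m∸n≤m; m<n⇒0<n∸m; ∸-monoʳ-<;
         ∸-monoˡ-≤; +-0-commutativeMonoid; +-commutativeSemigroup; module ≤-Reasoning)
open import Algebra.Properties.CommutativeMonoid.Sum +-0-commutativeMonoid
  using (sum-remove; ∑-distrib-+; sum-cong-≗) renaming (sum to ∑)
open import Algebra.Properties.CommutativeSemigroup +-commutativeSemigroup
  using (x∙yz≈y∙xz; xy∙z≈xz∙y)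
import Data.Parity.Base as ℙ
open import Data.Parity.Base using (1ℙ; _⁻¹)
open import Data.Parity.Properties using (+-homo-+; p≢p⁻¹)
open import Data.Product using (_×_; _,_; ∃-syntax)
open import Data.Sum using (_⊎_; inj₁; inj₂)
import Data.Sum as Sum
open import Data.Vec.Functional using (updateAt; removeAt; tail; _++_)
open import Data.Vec.Functional.Properties using (updateAt-updates; updateAt-minimal; lookup-++ʳ)
open import Defs
open import Function using (_∘_; const; id)
open import Function.Bundles using (_⇔_; mk⇔; Equivalence)
open import Relation.Binary.Definitions using (tri<; tri≈; tri>)
open import Relation.Binary.PropositionalEquality
  using (_≡_; _≢_; _≗_; refl; sym; trans; cong; cong₂; subst; module ≡-Reasoning)
open import Relation.Nullary using (¬_; yes; no; does)
open import Relation.Nullary.Decidable using (T?; dec-true; dec-false)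

-- Binary digits and the nim-sum

infixr 5 _∷ᵇ_

_∷ᵇ_ : Bool → ℕ → ℕ
r ∷ᵇ q = toℕᵇ r + q * 2

data LowBit : ℕ → Set where
  _∷_ : ∀ r q → LowBit (r ∷ᵇ q)

lowBit : ∀ a → LowBit a
lowBit zero = false ∷ 0
lowBit (suc a) with lowBit a
... | false ∷ q = true ∷ q
... | true  ∷ q = false ∷ suc q

-- Simultaneous binary expansions of two numbers, the shorter one padded with zero digits;
-- structural recursion on it replaces well-founded recursion on halving.
data Binary₂ : ℕ → ℕ → Set where
  []     : Binary₂ 0 0
  digits : ∀ r s {q t} → Binary₂ q t → Binary₂ (r ∷ᵇ q) (s ∷ᵇ t)

binary₂-sucˡ : ∀ {a b} → Binary₂ a b → Binary₂ (suc a) b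
binary₂-sucˡ []                 = digits true false []
binary₂-sucˡ (digits false s v) = digits true s v
binary₂-sucˡ (digits true  s v) = digits false s (binary₂-sucˡ v)

binary₂-swap : ∀ {a b} → Binary₂ a b → Binary₂ b a
binary₂-swap []             = []
binary₂-swap (digits r s v) = digits s r (binary₂-swap v)

binary₂ : ∀ a b → Binary₂ a b
binary₂ zero    zero    = []
binary₂ (suc a) b       = binary₂-sucˡ (binary₂ a b)
binary₂ zero    (suc b) = binary₂-swap (binary₂-sucˡ (binary₂-swap (binary₂ zero b)))

∷ᵇ-%2 : ∀ r q → (r ∷ᵇ q) % 2 ≡ toℕᵇ r
∷ᵇ-%2 false q = [m+kn]%n≡m%n 0 q 2
∷ᵇ-%2 true  q = [m+kn]%n≡m%n 1 q 2

∷ᵇ-/2 : ∀ r q → (r ∷ᵇ q) / 2 ≡ q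
∷ᵇ-/2 false q = trans (+-distrib-/-∣ʳ 0 (n∣m*n q {2})) (m*n/n≡m q 2)
∷ᵇ-/2 true  q = trans (+-distrib-/-∣ʳ 1 (n∣m*n q {2})) (m*n/n≡m q 2)

xorF-zeros : ∀ f → xorF f 0 0 ≡ 0
xorF-zeros zero    = refl
xorF-zeros (suc f) = cong (2 *_) (xorF-zeros f)

/2-≤ : ∀ {a f} → a ≤ suc f → a / 2 ≤ f
/2-≤ {a} {f} a≤ = ≤-trans (/-monoˡ-≤ 2 a≤) (≤-pred (m/n<m (suc f) 2 (s≤s (s≤s z≤n))))

xorF-stable : ∀ {f g a b} → a ≤ f → b ≤ f → f ≤ g → xorF g a b ≡ xorF f a b
xorF-stable {zero}  {g} z≤n z≤n _ = xorF-zeros g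
xorF-stable {suc f} {suc g} {a} {b} a≤ b≤ (s≤s f≤g) =
  cong (λ x → (if a % 2 ≡ᵇ b % 2 then 0 else 1) + 2 * x)
       (xorF-stable (/2-≤ a≤) (/2-≤ b≤) f≤g)

⊕-unfold : ∀ a b → a ⊕ b ≡ (if a % 2 ≡ᵇ b % 2 then 0 else 1) + 2 * (a / 2 ⊕ b / 2)
⊕-unfold a b = trans
  (sym (xorF-stable (m≤m+n a b) (m≤n+m b a) (n≤1+n _)))
  (cong (λ x → (if a % 2 ≡ᵇ b % 2 then 0 else 1) + 2 * x)
        (xorF-stable (m≤m+n (a / 2) (b / 2)) (m≤n+m (b / 2) (a / 2))
                     (+-mono-≤ (m/n≤m a 2) (m/n≤m b 2))))

toℕᵇ-xor : ∀ r s → (if toℕᵇ r ≡ᵇ toℕᵇ s then 0 else 1) ≡ toℕᵇ (r xor s)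
toℕᵇ-xor false false = refl
toℕᵇ-xor false true  = refl
toℕᵇ-xor true  false = refl
toℕᵇ-xor true  true  = refl

⊕-∷ᵇ : ∀ r s q t → (r ∷ᵇ q) ⊕ (s ∷ᵇ t) ≡ (r xor s) ∷ᵇ (q ⊕ t)
⊕-∷ᵇ r s q t
  rewrite ⊕-unfold (r ∷ᵇ q) (s ∷ᵇ t) | ∷ᵇ-%2 r q | ∷ᵇ-%2 s t | ∷ᵇ-/2 r q | ∷ᵇ-/2 s t
  = cong₂ _+_ (toℕᵇ-xor r s) (*-comm 2 (q ⊕ t))

⊕-comm : ∀ a b → a ⊕ b ≡ b ⊕ a
⊕-comm a b = go (binary₂ a b)
  where
  open ≡-Reasoning
  go : ∀ {a b} → Binary₂ a b → a ⊕ b ≡ b ⊕ a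
  go []                       = refl
  go (digits r s {q} {t} q,t) = begin
    (r ∷ᵇ q) ⊕ (s ∷ᵇ t)   ≡⟨ ⊕-∷ᵇ r s q t ⟩
    (r xor s) ∷ᵇ (q ⊕ t)  ≡⟨ cong₂ _∷ᵇ_ (xor-comm r s) (go q,t) ⟩
    (s xor r) ∷ᵇ (t ⊕ q)  ≡⟨ ⊕-∷ᵇ s r t q ⟨
    (s ∷ᵇ t) ⊕ (r ∷ᵇ q)   ∎

xor-involutive : ∀ r s → r xor (r xor s) ≡ s
xor-involutive r s = trans (sym (xor-assoc r r s)) (cong (_xor s) (xor-same r))

⊕-involutive : ∀ a b → a ⊕ (a ⊕ b) ≡ b
⊕-involutive a b = go (binary₂ a b)
  where
  open ≡-Reasoning
  go : ∀ {a b} → Binary₂ a b → a ⊕ (a ⊕ b) ≡ b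
  go []                       = refl
  go (digits r s {q} {t} q,t) = begin
    (r ∷ᵇ q) ⊕ ((r ∷ᵇ q) ⊕ (s ∷ᵇ t))        ≡⟨ cong ((r ∷ᵇ q) ⊕_) (⊕-∷ᵇ r s q t) ⟩
    (r ∷ᵇ q) ⊕ ((r xor s) ∷ᵇ (q ⊕ t))       ≡⟨ ⊕-∷ᵇ r (r xor s) q (q ⊕ t) ⟩
    (r xor (r xor s)) ∷ᵇ (q ⊕ (q ⊕ t))      ≡⟨ cong₂ _∷ᵇ_ (xor-involutive r s) (go q,t) ⟩
    s ∷ᵇ t                                  ∎

⊕-cancelˡ : ∀ c {a b} → c ⊕ a ≡ c ⊕ b → a ≡ b
⊕-cancelˡ c {a} {b} e = begin
  a            ≡⟨ ⊕-involutive c a ⟨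
  c ⊕ (c ⊕ a)  ≡⟨ cong (c ⊕_) e ⟩
  c ⊕ (c ⊕ b)  ≡⟨ ⊕-involutive c b ⟩
  b            ∎
  where open ≡-Reasoning

⊕-cancelʳ : ∀ c {a b} → a ⊕ c ≡ b ⊕ c → a ≡ b
⊕-cancelʳ c {a} {b} e = ⊕-cancelˡ c (trans (⊕-comm c a) (trans e (⊕-comm b c)))

toℕᵇ≤1 : ∀ r → toℕᵇ r ≤ 1
toℕᵇ≤1 false = z≤n
toℕᵇ≤1 true  = s≤s z≤n

∷ᵇ-<-∷ᵇ : ∀ r s {q t} → q < t → r ∷ᵇ q < s ∷ᵇ t
∷ᵇ-<-∷ᵇ r s {q} {t} q<t = begin-strict
  toℕᵇ r + q * 2  ≤⟨ +-monoˡ-≤ (q * 2) (toℕᵇ≤1 r) ⟩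
  1 + q * 2       <⟨ n<1+n _ ⟩
  suc q * 2       ≤⟨ *-monoˡ-≤ 2 q<t ⟩
  t * 2           ≤⟨ m≤n+m (t * 2) (toℕᵇ s) ⟩
  toℕᵇ s + t * 2  ∎
  where open ≤-Reasoning

∷ᵇ-<-∷ᵇ⁻¹ : ∀ {r s q t} → r ∷ᵇ q < s ∷ᵇ t → q < t ⊎ (q ≡ t × r ≡ false × s ≡ true)
∷ᵇ-<-∷ᵇ⁻¹ {r} {s} {q} {t} lt with <-cmp q t
... | tri< q<t _ _ = inj₁ q<t
... | tri≈ _ refl _ = inj₂ (refl , toℕᵇ-< r s (+-cancelʳ-< (q * 2) (toℕᵇ r) (toℕᵇ s) lt))
  where
  toℕᵇ-< : ∀ r s → toℕᵇ r < toℕᵇ s → r ≡ false × s ≡ true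
  toℕᵇ-< false true  _ = refl , refl
  toℕᵇ-< false false ()
  toℕᵇ-< true  false ()
  toℕᵇ-< true  true  (s≤s ())
... | tri> _ _ t<q = ⊥-elim (<-asym lt (∷ᵇ-<-∷ᵇ s r t<q))

NimMove : ℕ → ℕ → ℕ → Set
NimMove a b k = ∃[ a′ ] a′ < a × a′ ⊕ b ≡ k

nimMove-∷ᵇ : ∀ r s u {q t k} → NimMove q t k → NimMove (r ∷ᵇ q) (s ∷ᵇ t) (u ∷ᵇ k)
nimMove-∷ᵇ r s u {q} {t} {k} (q′ , q′<q , q′⊕t≡k) =
  (u xor s) ∷ᵇ q′ , ∷ᵇ-<-∷ᵇ (u xor s) r q′<q , (begin
    ((u xor s) ∷ᵇ q′) ⊕ (s ∷ᵇ t)  ≡⟨ ⊕-∷ᵇ (u xor s) s q′ t ⟩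
    ((u xor s) xor s) ∷ᵇ (q′ ⊕ t) ≡⟨ cong₂ _∷ᵇ_ xor-cancel q′⊕t≡k ⟩
    u ∷ᵇ k                        ∎)
  where
  open ≡-Reasoning
  xor-cancel : (u xor s) xor s ≡ u
  xor-cancel = trans (xor-assoc u s s) (trans (cong (u xor_) (xor-same s)) (xor-identityʳ u))

drop-low-bit : ∀ q t → NimMove (true ∷ᵇ q) (false ∷ᵇ t) (false ∷ᵇ (q ⊕ t))
drop-low-bit q t = false ∷ᵇ q , n<1+n _ , ⊕-∷ᵇ false false q t

-- Either k already differs from a ⊕ b above the lowest bit, which the halves handle, or only
-- in the lowest bit, which the heap whose lowest bit is 1 drops.
⊕-reachable : ∀ a b {k} → k < a ⊕ b → NimMove a b k ⊎ NimMove b a k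
⊕-reachable a b = go (binary₂ a b)
  where
  go : ∀ {a b k} → Binary₂ a b → k < a ⊕ b → NimMove a b k ⊎ NimMove b a k
  go [] ()
  go {k = k} (digits r s {q} {t} q,t) lt with lowBit k
  ... | u ∷ k′ with ∷ᵇ-<-∷ᵇ⁻¹ {u} {r xor s} {k′} {q ⊕ t} (subst (u ∷ᵇ k′ <_) (⊕-∷ᵇ r s q t) lt)
  ...   | inj₁ k′<q⊕t = Sum.map (nimMove-∷ᵇ r s u) (nimMove-∷ᵇ s r u) (go q,t k′<q⊕t)
  ...   | inj₂ (refl , refl , r⊕s≡1) with r | s
  ...     | true  | false = inj₁ (drop-low-bit q t)
  ...     | false | true  =
    inj₂ (subst (NimMove _ _) (cong (false ∷ᵇ_) (⊕-comm t q)) (drop-low-bit t q))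
  ...     | false | false with () ← r⊕s≡1
  ...     | true  | true  with () ← r⊕s≡1

parity-∷ᵇ : ∀ r q → parity (r ∷ᵇ q) ≡ parity (toℕᵇ r)
parity-∷ᵇ false zero    = refl
parity-∷ᵇ true  zero    = refl
parity-∷ᵇ false (suc q) = parity-∷ᵇ false q
parity-∷ᵇ true  (suc q) = parity-∷ᵇ true q

parity-toℕᵇ-xor : ∀ r s → parity (toℕᵇ (r xor s)) ≡ parity (toℕᵇ r) ℙ.+ parity (toℕᵇ s)
parity-toℕᵇ-xor false s     = refl
parity-toℕᵇ-xor true  false = refl
parity-toℕᵇ-xor true  true  = refl

parity-⊕ : ∀ a b → parity (a ⊕ b) ≡ parity (a + b)
parity-⊕ a b with lowBit a | lowBit b
... | r ∷ q | s ∷ t = begin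
  parity ((r ∷ᵇ q) ⊕ (s ∷ᵇ t))             ≡⟨ cong parity (⊕-∷ᵇ r s q t) ⟩
  parity ((r xor s) ∷ᵇ (q ⊕ t))            ≡⟨ parity-∷ᵇ (r xor s) (q ⊕ t) ⟩
  parity (toℕᵇ (r xor s))                  ≡⟨ parity-toℕᵇ-xor r s ⟩
  parity (toℕᵇ r) ℙ.+ parity (toℕᵇ s)      ≡⟨ cong₂ ℙ._+_ (parity-∷ᵇ r q) (parity-∷ᵇ s t) ⟨
  parity (r ∷ᵇ q) ℙ.+ parity (s ∷ᵇ t)      ≡⟨ +-homo-+ (r ∷ᵇ q) (s ∷ᵇ t) ⟨
  parity ((r ∷ᵇ q) + (s ∷ᵇ t))             ∎
  where open ≡-Reasoning

-- Nim-sums of finite families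

⨁-cong : ∀ {m} {y y′ : Fin m → ℕ} → y ≗ y′ → ⨁ y ≡ ⨁ y′
⨁-cong {zero}  _    = refl
⨁-cong {suc m} y≗y′ = cong₂ _⊕_ (y≗y′ zero) (⨁-cong (y≗y′ ∘ suc))

⨁-updateAt-≢ : ∀ {m} (y : Fin m → ℕ) j f → f (y j) ≢ y j → ⨁ (updateAt y j f) ≢ ⨁ y
⨁-updateAt-≢ y zero    f fy≢y e = fy≢y (⊕-cancelʳ _ e)
⨁-updateAt-≢ y (suc j) f fy≢y e = ⨁-updateAt-≢ (tail y) j f fy≢y (⊕-cancelˡ (y zero) e)

⨁-reachable : ∀ {m} (y : Fin m → ℕ) {k} → k < ⨁ y →
              ∃[ j ] ∃[ c ] c < y j × ⨁ (updateAt y j (const c)) ≡ k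
⨁-reachable {suc m} y {k} k< with ⊕-reachable (y zero) (⨁ (tail y)) k<
... | inj₁ (c , c< , c⊕rest≡k) = zero , c , c< , c⊕rest≡k
... | inj₂ (b , b< , b⊕y₀≡k) with ⨁-reachable (tail y) b<
...   | j , c , c< , rest≡b = suc j , c , c< , (begin
  y zero ⊕ ⨁ (updateAt (tail y) j (const c))  ≡⟨ cong (y zero ⊕_) rest≡b ⟩
  y zero ⊕ b                                 ≡⟨ ⊕-comm (y zero) b ⟩
  b ⊕ y zero                                 ≡⟨ b⊕y₀≡k ⟩
  k                                          ∎)
  where open ≡-Reasoning

parity-⨁ : ∀ {m} (y : Fin m → ℕ) → parity (⨁ y) ≡ parity (∑ y)
parity-⨁ {zero}  y = refl
parity-⨁ {suc m} y = begin
  parity (y zero ⊕ ⨁ (tail y))                ≡⟨ parity-⊕ (y zero) (⨁ (tail y)) ⟩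
  parity (y zero + ⨁ (tail y))                ≡⟨ +-homo-+ (y zero) (⨁ (tail y)) ⟩
  parity (y zero) ℙ.+ parity (⨁ (tail y))     ≡⟨ cong (parity (y zero) ℙ.+_) (parity-⨁ (tail y)) ⟩
  parity (y zero) ℙ.+ parity (∑ (tail y))     ≡⟨ +-homo-+ (y zero) (∑ (tail y)) ⟨
  parity (y zero + ∑ (tail y))                ∎
  where open ≡-Reasoning

∑-suc : ∀ {m} (y : Fin m → ℕ) → ∑ (suc ∘ y) ≡ m + ∑ y
∑-suc {zero}  y = refl
∑-suc {suc m} y =
  cong suc (trans (cong (y zero +_) (∑-suc (tail y))) (x∙yz≈y∙xz (y zero) m (∑ (tail y))))

⨁-suc-≢ : ∀ {m} (y : Fin m → ℕ) → parity m ≡ 1ℙ → ⨁ (suc ∘ y) ≢ ⨁ y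
⨁-suc-≢ {m} y odd e = p≢p⁻¹ (parity (∑ y)) (begin
  parity (∑ y)                   ≡⟨ parity-⨁ y ⟨
  parity (⨁ y)                   ≡⟨ cong parity e ⟨
  parity (⨁ (suc ∘ y))           ≡⟨ parity-⨁ (suc ∘ y) ⟩
  parity (∑ (suc ∘ y))           ≡⟨ cong parity (∑-suc y) ⟩
  parity (m + ∑ y)               ≡⟨ +-homo-+ m (∑ y) ⟩
  parity m ℙ.+ parity (∑ y)      ≡⟨ cong (ℙ._+ parity (∑ y)) odd ⟩
  parity (∑ y) ⁻¹                ∎)
  where open ≡-Reasoning

%2≡1⇒parity≡1ℙ : ∀ m → m % 2 ≡ 1 → parity m ≡ 1ℙ
%2≡1⇒parity≡1ℙ 0             ()
%2≡1⇒parity≡1ℙ 1             _ = refl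
%2≡1⇒parity≡1ℙ (suc (suc m)) h = %2≡1⇒parity≡1ℙ m h

-- The mex of a list

∈ᵇ⇔∈ : ∀ {k xs} → T (k ∈ᵇ xs) ⇔ k ∈ xs
∈ᵇ⇔∈ {k} {xs} = mk⇔
  (Any.map (λ {x} x≡ᵇk → sym (≡ᵇ⇒≡ x k x≡ᵇk)) ∘ any⁻ (_≡ᵇ k) xs)
  (any⁺ (_≡ᵇ k) ∘ Any.map (λ {x} k≡x → ≡⇒≡ᵇ x k (sym k≡x)))

below⊆⇒≤length : ∀ {v xs} → (∀ {j} → j < v → j ∈ xs) → v ≤ length xs
below⊆⇒≤length {v} {xs} below with v ≤? length xs
... | yes v≤ = v≤
... | no  v≰ = ⊥-elim (no-collision (pigeonhole (≰⇒> v≰) position))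
  where
  open ≡-Reasoning
  position : Fin v → Fin (length xs)
  position i = Any.index (below (toℕ<n i))
  no-collision : ¬ (∃[ i ] ∃[ i′ ] i Fin.< i′ × position i ≡ position i′)
  no-collision (i , i′ , i<i′ , same) = <⇒≢ i<i′ (begin
    toℕ i                     ≡⟨ lookup-index (below (toℕ<n i)) ⟩
    lookup xs (position i)    ≡⟨ cong (lookup xs) same ⟩
    lookup xs (position i′)   ≡⟨ lookup-index (below (toℕ<n i′)) ⟨
    toℕ i′                    ∎)

mexSearch-≡ : ∀ f {k v xs} → k ≤ v → v ≤ k + f →
              (∀ {j} → k ≤ j → j < v → j ∈ xs) → v ∉ xs → mexSearch f k xs ≡ v
mexSearch-≡ zero    {k} {v} k≤v v≤k+0 _ _ = ≤-antisym k≤v (subst (v ≤_) (+-identityʳ k) v≤k+0)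
mexSearch-≡ (suc f) {k} {v} {xs} k≤v v≤k+f below v∉ with k ≟ v
... | yes refl rewrite dec-false (T? (k ∈ᵇ xs)) (v∉ ∘ Equivalence.to ∈ᵇ⇔∈) = refl
... | no  k≢v
  rewrite dec-true (T? (k ∈ᵇ xs)) (Equivalence.from ∈ᵇ⇔∈ (below ≤-refl (≤∧≢⇒< k≤v k≢v))) =
  mexSearch-≡ f (≤∧≢⇒< k≤v k≢v) (subst (v ≤_) (+-suc k f) v≤k+f) (below ∘ <⇒≤) v∉

mex-≡ : ∀ {v xs} → (∀ {j} → j < v → j ∈ xs) → v ∉ xs → mex xs ≡ v
mex-≡ below v∉ = mexSearch-≡ _ z≤n (below⊆⇒≤length below) (λ _ → below) v∉

mexSearch-suc-≢0 : ∀ f k xs → (mexSearch f (suc k) xs ≡ᵇ 0) ≡ false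
mexSearch-suc-≢0 zero    k xs = refl
mexSearch-suc-≢0 (suc f) k xs with suc k ∈ᵇ xs
... | true  = mexSearch-suc-≢0 f (suc k) xs
... | false = refl

mex≡ᵇ0 : ∀ xs → (mex xs ≡ᵇ 0) ≡ not (0 ∈ᵇ xs)
mex≡ᵇ0 []           = refl
mex≡ᵇ0 xs@(_ ∷ xs′) with 0 ∈ᵇ xs
... | true  = mexSearch-suc-≢0 (length xs′) 0 xs
... | false = refl

not-or-map : ∀ {A : Set} (p : A → Bool) xs → not (or (map p xs)) ≡ and (map (not ∘ p) xs)
not-or-map p []       = refl
not-or-map p (x ∷ xs) with p x
... | true  = refl
... | false = not-or-map p xs

-- Digraph Yama Nim

sum-map-allFin : ∀ {N} (t : Fin N → ℕ) → sum (map t (allFin N)) ≡ ∑ t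
sum-map-allFin t = trans (cong sum (map-tabulate id t)) (sum-tabulate t)
  where
  sum-tabulate : ∀ {N} (t : Fin N → ℕ) → sum (tabulate t) ≡ ∑ t
  sum-tabulate {zero}  t = refl
  sum-tabulate {suc N} t = cong (t zero +_) (sum-tabulate (tail t))

≤-∑ : ∀ {N} (t : Fin N → ℕ) i → t i ≤ ∑ t
≤-∑ {suc N} t i = subst (t i ≤_) (sym (sum-remove {i = i} t)) (m≤m+n (t i) _)

outdeg≡0⇒¬adj : ∀ {N} (G : Digraph N) v u → outdeg G v ≡ 0 → adj G v u ≡ false
outdeg≡0⇒¬adj G v u od≡0 = toℕᵇ≤0 (subst (toℕᵇ (adj G v u) ≤_) ∑≡0 (≤-∑ (toℕᵇ ∘ adj G v) u))
  where
  ∑≡0 : ∑ (toℕᵇ ∘ adj G v) ≡ 0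
  ∑≡0 = trans (sym (sum-map-allFin (toℕᵇ ∘ adj G v))) od≡0
  toℕᵇ≤0 : ∀ {b} → toℕᵇ b ≤ 0 → b ≡ false
  toℕᵇ≤0 {false} _ = refl

move-self : ∀ {N} (G : Digraph N) p v r → move G p v r v ≡ p v ∸ r
move-self G p v r rewrite dec-true (v Fin.≟ v) refl | loopless G v = +-identityʳ (p v ∸ r)

move-other : ∀ {N} (G : Digraph N) p {v} r {u} → u ≢ v →
             move G p v r u ≡ p u + toℕᵇ (adj G v u)
move-other G p {v} r {u} u≢v rewrite dec-false (u Fin.≟ v) u≢v = refl

Legal : ∀ {N} → Digraph N → Position N → Fin N → ℕ → Set
Legal G p v r = outdeg G v < r × r ≤ p v

<∸⇒+< : ∀ a b {i} → i < a ∸ b → b + i < a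
<∸⇒+< (suc a) zero    i<a   = i<a
<∸⇒+< (suc a) (suc b) i<a∸b = s≤s (<∸⇒+< a b i<a∸b)

-- options G p is concatMap (movesAt G p) (allFin _) by definition.
movesAt : ∀ {N} → Digraph N → Position N → Fin N → List (Position N)
movesAt G p v = map (λ i → move G p v (suc (outdeg G v) + i)) (upTo (p v ∸ outdeg G v))

∈-options⁺ : ∀ {N} (G : Digraph N) p {v r} → Legal G p v r → move G p v r ∈ options G p
∈-options⁺ G p {v} {r} (od<r , r≤pv) = ∈-concatMap⁺ (movesAt G p) (lose (∈-allFin v) move∈)
  where
  od = outdeg G v
  i< : r ∸ suc od < p v ∸ od
  i< = <-≤-trans (∸-monoʳ-< (n<1+n od) od<r) (∸-monoˡ-≤ od r≤pv)
  move∈ : move G p v r ∈ movesAt G p v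
  move∈ = subst (λ r′ → move G p v r′ ∈ movesAt G p v) (m+[n∸m]≡n od<r) (∈-map⁺ _ (∈-upTo⁺ i<))

∈-options⁻ : ∀ {N} (G : Digraph N) p {q} → q ∈ options G p →
             ∃[ v ] ∃[ r ] Legal G p v r × q ≡ move G p v r
∈-options⁻ G p q∈ with find (∈-concatMap⁻ (movesAt G p) {xs = allFin _} q∈)
... | v , _ , q∈movesAt with ∈-map⁻ (λ i → move G p v (suc (outdeg G v) + i)) q∈movesAt
...   | i , i∈ , refl =
  v , suc (outdeg G v) + i , (s≤s (m≤m+n _ i) , <∸⇒+< (p v) (outdeg G v) (∈-upTo⁻ i∈)) , refl

total-move< : ∀ {N} (G : Digraph N) p {v r} → Legal G p v r → total (move G p v r) < total p
total-move< {suc N} G p {v} {r} (od<r , r≤pv) = begin-strict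
  total (move G p v r)                       ≡⟨ sum-map-allFin (move G p v r) ⟩
  ∑ (λ u → lowered u + edges u)              ≡⟨ ∑-distrib-+ lowered edges ⟩
  ∑ lowered + ∑ edges                        ≡⟨ cong₂ _+_ ∑-lowered (sym (sum-map-allFin edges)) ⟩
  (p v ∸ r + rest) + outdeg G v              ≡⟨ xy∙z≈xz∙y (p v ∸ r) rest (outdeg G v) ⟩
  (p v ∸ r + outdeg G v) + rest              <⟨ +-monoˡ-< rest removed-enough ⟩
  p v + rest                                 ≡⟨ sum-remove p ⟨
  ∑ p                                        ≡⟨ sum-map-allFin p ⟨
  total p                                    ∎
  where
  open ≤-Reasoning
  lowered edges : Fin (suc N) → ℕ
  lowered u = if does (u Fin.≟ v) then p v ∸ r else p u
  edges u = toℕᵇ (adj G v u)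
  rest : ℕ
  rest = ∑ (removeAt p v)
  lowered-off : ∀ j → lowered (punchIn v j) ≡ p (punchIn v j)
  lowered-off j rewrite dec-false (punchIn v j Fin.≟ v) (punchInᵢ≢i v j) = refl
  ∑-lowered : ∑ lowered ≡ p v ∸ r + rest
  ∑-lowered rewrite sum-remove {i = v} lowered | dec-true (v Fin.≟ v) refl =
    cong (p v ∸ r +_) (sum-cong-≗ lowered-off)
  removed-enough : p v ∸ r + outdeg G v < p v
  removed-enough = <-≤-trans (+-monoʳ-< (p v ∸ r) od<r) (≤-reflexive (m∸n+n≡m r≤pv))

total-option< : ∀ {N} (G : Digraph N) p {q} → q ∈ options G p → total q < total p
total-option< G p q∈ with ∈-options⁻ G p q∈
... | _ , _ , legal , refl = total-move< G p legal

grundy-unique : ∀ {N} (G : Digraph N) (value : Position N → ℕ) →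
                (∀ {p q} → q ∈ options G p → value q ≢ value p) →
                (∀ {p k} → k < value p → ∃[ q ] q ∈ options G p × value q ≡ k) →
                ∀ p → grundy G p ≡ value p
grundy-unique G value options-differ below-reachable p = grundyF-≡ (suc (total p)) p ≤-refl
  where
  grundyF-≡ : ∀ f p → total p < f → grundyF G f p ≡ value p
  grundyF-≡ (suc f) p total<1+f = mex-≡ below value∉
    where
    IH : ∀ {q} → q ∈ options G p → grundyF G f q ≡ value q
    IH {q} q∈ = grundyF-≡ f q (<-≤-trans (total-option< G p q∈) (≤-pred total<1+f))
    below : ∀ {k} → k < value p → k ∈ map (grundyF G f) (options G p)
    below k< with below-reachable k<
    ... | q , q∈ , refl = subst (_∈ _) (IH q∈) (∈-map⁺ (grundyF G f) q∈)
    value∉ : value p ∉ map (grundyF G f) (options G p)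
    value∉ value∈ with ∈-map⁻ (grundyF G f) value∈
    ... | q , q∈ , value≡ = options-differ q∈ (sym (trans value≡ (IH q∈)))

isPF≡grundyF≡ᵇ0 : ∀ {N} (G : Digraph N) f p → isPF G f p ≡ (grundyF G f p ≡ᵇ 0)
isPF≡grundyF≡ᵇ0 G zero    p = refl
isPF≡grundyF≡ᵇ0 G (suc f) p = begin
  and (map (λ q → not (isPF G f q)) (options G p))
    ≡⟨ cong and (map-cong (λ q → cong not (isPF≡grundyF≡ᵇ0 G f q)) (options G p)) ⟩
  and (map (not ∘ (_≡ᵇ 0) ∘ grundyF G f) (options G p))
    ≡⟨ cong and (map-∘ (options G p)) ⟩
  and (map (not ∘ (_≡ᵇ 0)) values)
    ≡⟨ not-or-map (_≡ᵇ 0) values ⟨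
  not (0 ∈ᵇ values)
    ≡⟨ mex≡ᵇ0 values ⟨
  mex values ≡ᵇ 0
    ∎
  where
  open ≡-Reasoning
  values = map (grundyF G f) (options G p)

IsPPosition⇔grundy≡0 : ∀ {N} (G : Digraph N) p → IsPPosition G p ⇔ grundy G p ≡ 0
IsPPosition⇔grundy≡0 G p =
  subst (λ b → (b ≡ true) ⇔ (grundy G p ≡ 0))
        (sym (isPF≡grundyF≡ᵇ0 G (suc (total p)) p))
        (≡ᵇ0⇔≡0 (grundy G p))
  where
  ≡ᵇ0⇔≡0 : ∀ x → (x ≡ᵇ 0) ≡ true ⇔ x ≡ 0
  ≡ᵇ0⇔≡0 zero    = mk⇔ (λ _ → refl) (λ _ → refl)
  ≡ᵇ0⇔≡0 (suc x) = mk⇔ (λ ()) (λ ())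

-- The digraph G₄

data Split (n m : ℕ) : Fin (n + m) → Set where
  left  : (i : Fin n) → Split n m (i ↑ˡ m)
  right : (j : Fin m) → Split n m (n ↑ʳ j)

split : ∀ n m v → Split n m v
split zero    m v       = right v
split (suc n) m zero    = left zero
split (suc n) m (suc v) with split n m v
... | left  i = left (suc i)
... | right j = right j

↑ˡ≢↑ʳ : ∀ {n m} (i : Fin n) (j : Fin m) → i ↑ˡ m ≢ n ↑ʳ j
↑ˡ≢↑ʳ {n} {m} i j e
  with () ← trans (sym (splitAt-↑ˡ n i m)) (trans (cong (splitAt n) e) (splitAt-↑ʳ n m j))

module G₄ {n m : ℕ} (G : Digraph (n + m))
  (complete : ∀ (i : Fin n) (j : Fin m) → adj G (i ↑ˡ m) (n ↑ʳ j) ≡ true)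
  (sinks : ∀ (j : Fin m) → outdeg G (n ↑ʳ j) ≡ 0)
  (odd : parity m ≡ 1ℙ)
  where

  heaps : Position (n + m) → Fin m → ℕ
  heaps p j = p (n ↑ʳ j)

  value : Position (n + m) → ℕ
  value p = ⨁ (heaps p)

  heaps-move-left : ∀ p i r → heaps (move G p (i ↑ˡ m) r) ≗ suc ∘ heaps p
  heaps-move-left p i r j = begin
    move G p (i ↑ˡ m) r (n ↑ʳ j)
      ≡⟨ move-other G p r (↑ˡ≢↑ʳ i j ∘ sym) ⟩
    p (n ↑ʳ j) + toℕᵇ (adj G (i ↑ˡ m) (n ↑ʳ j))
      ≡⟨ cong (λ b → p (n ↑ʳ j) + toℕᵇ b) (complete i j) ⟩
    p (n ↑ʳ j) + 1
      ≡⟨ +-comm (p (n ↑ʳ j)) 1 ⟩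
    suc (p (n ↑ʳ j))
      ∎
    where open ≡-Reasoning

  heaps-move-right : ∀ p j r →
                     heaps (move G p (n ↑ʳ j) r) ≗ updateAt (heaps p) j (const (heaps p j ∸ r))
  heaps-move-right p j r j′ with j′ Fin.≟ j
  ... | yes refl = trans (move-self G p (n ↑ʳ j) r) (sym (updateAt-updates j (heaps p)))
  ... | no  j′≢j = begin
    move G p (n ↑ʳ j) r (n ↑ʳ j′)
      ≡⟨ move-other G p r (j′≢j ∘ ↑ʳ-injective n j′ j) ⟩
    p (n ↑ʳ j′) + toℕᵇ (adj G (n ↑ʳ j) (n ↑ʳ j′))
      ≡⟨ cong (λ b → p (n ↑ʳ j′) + toℕᵇ b) (outdeg≡0⇒¬adj G _ _ (sinks j)) ⟩
    p (n ↑ʳ j′) + 0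
      ≡⟨ +-identityʳ (p (n ↑ʳ j′)) ⟩
    heaps p j′
      ≡⟨ updateAt-minimal j′ j (heaps p) j′≢j ⟨
    updateAt (heaps p) j (const (heaps p j ∸ r)) j′
      ∎
    where open ≡-Reasoning

  option-value-≢ : ∀ {p q} → q ∈ options G p → value q ≢ value p
  option-value-≢ {p} q∈ with ∈-options⁻ G p q∈
  ... | v , r , (od<r , r≤) , refl with split n m v
  ...   | left  i = ⨁-suc-≢ (heaps p) odd ∘ trans (sym (⨁-cong (heaps-move-left p i r)))
  ...   | right j =
    ⨁-updateAt-≢ (heaps p) j _ lowered ∘ trans (sym (⨁-cong (heaps-move-right p j r)))
    where
    lowered : heaps p j ∸ r ≢ heaps p j
    lowered = <⇒≢ (∸-monoʳ-< (≤-<-trans z≤n od<r) r≤)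

  value-reachable : ∀ {p k} → k < value p → ∃[ q ] q ∈ options G p × value q ≡ k
  value-reachable {p} {k} k< with ⨁-reachable (heaps p) k<
  ... | j , c , c< , ⨁≡k = move G p (n ↑ʳ j) r , ∈-options⁺ G p legal , (begin
    value (move G p (n ↑ʳ j) r)
      ≡⟨ ⨁-cong (heaps-move-right p j r) ⟩
    ⨁ (updateAt (heaps p) j (const (heaps p j ∸ r)))
      ≡⟨ cong (λ c′ → ⨁ (updateAt (heaps p) j (const c′))) (m∸[m∸n]≡n (<⇒≤ c<)) ⟩
    ⨁ (updateAt (heaps p) j (const c))
      ≡⟨ ⨁≡k ⟩
    k
      ∎)
    where
    open ≡-Reasoning
    r = heaps p j ∸ c
    legal : Legal G p (n ↑ʳ j) r
    legal = subst (_< r) (sym (sinks j)) (m<n⇒0<n∸m c<) , m∸n≤m (heaps p j) c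

  grundy≡value : ∀ p → grundy G p ≡ value p
  grundy≡value = grundy-unique G value option-value-≢ value-reachable

theorem8 : (n m : ℕ) (G : Digraph (n + m))
    → (∀ (i : Fin n) (j : Fin m) → adj G (i ↑ˡ m) (n ↑ʳ j) ≡ true)
    → (∀ (j : Fin m) → outdeg G (n ↑ʳ j) ≡ 0)
    → m % 2 ≡ 1
    → (x : Fin n → ℕ) (y : Fin m → ℕ)
    → (grundy G (x ++ y) ≡ ⨁ y)
      × (IsPPosition G (x ++ y) ⇔ (⨁ y ≡ 0))
theorem8 n m G complete sinks m-odd x y =
  grundy≡⨁ ,
  subst (λ g → IsPPosition G (x ++ y) ⇔ (g ≡ 0)) grundy≡⨁ (IsPPosition⇔grundy≡0 G (x ++ y))
  where
  open G₄ G complete sinks (%2≡1⇒parity≡1ℙ m m-odd)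
  grundy≡⨁ : grundy G (x ++ y) ≡ ⨁ y
  grundy≡⨁ = trans (grundy≡value (x ++ y)) (⨁-cong (lookup-++ʳ x y))
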